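{- (Completeness.) For every set of sequents $S$ and every sequent $s$: if $\tau(S)\vDash_{\mathcal{CHA}}\tau(s)$, then $S\vdash_{\mathtt{CHC}}s$.
   Context: Formulas are built from variables with binary $\wedge,\vee,\rightarrow$ and constants $0,1$; $\neg\alpha:=\alpha\rightarrow 0$. A sequent $\Gamma\blacktriangleright\Pi$ is a pair of a finite set $\Gamma$ of formulas and a set $\Pi$ that is empty or a singleton; commas denote union. $\mathtt{CHC}$ has axioms (id) $\alpha\blacktriangleright\alpha$; (0) $0\blacktriangleright$; (1) $\blacktriangleright 1$; rules (w-l) $\Gamma\blacktriangleright\Pi/\alpha,\Gamma\blacktriangleright\Pi$; (w-r) $\Gamma\blacktriangleright/\Gamma\blacktriangleright\alpha$; (cut) $\Gamma\blacktriangleright\alpha$, $\alpha,\Delta\blacktriangleright\Pi/\Gamma,\Delta\blacktriangleright\Pi$; ($\wedge$-l) $\alpha,\Gamma\blacktriangleright\Pi/\alpha\wedge\beta,\Gamma\blacktriangleright\Pi$ and $\beta,\Gamma\blacktriangleright\Pi/\alpha\wedge\beta,\Gamma\blacktriangleright\Pi$; ($\wedge$-r) $\Gamma\blacktriangleright\alpha$, $\Gamma\blacktriangleright\beta/\Gamma\blacktriangleright\alpha\wedge\beta$; ($\vee$-r) $\Gamma\blacktriangleright\alpha/\Gamma\blacktriangleright\alpha\vee\beta$ and $\Gamma\blacktriangleright\beta/\Gamma\blacktriangleright\alpha\vee\beta$; ($\vee$-l) $\alpha,\Gamma\blacktriangleright\Pi$, $\beta,\Gamma\blacktriangleright\Pi/\alpha\vee\beta,\Gamma\blacktriangleright\Pi$;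 ($\rightarrow$-l(a)) $\Gamma\blacktriangleright\alpha$, $\Delta,\beta\blacktriangleright\Pi/\Delta,\Gamma,\alpha\rightarrow\beta\blacktriangleright\Pi$; ($\rightarrow$-l(b)) $\neg\alpha,\Gamma\blacktriangleright\beta$, $\Delta,\alpha,\beta\blacktriangleright/\Gamma,\Delta,\alpha\rightarrow\beta\blacktriangleright$; ($\rightarrow$-r) $\alpha,\Gamma\blacktriangleright\beta$, $\Delta,\neg\alpha,\beta\blacktriangleright/\Gamma,\Delta\blacktriangleright\alpha\rightarrow\beta$. $S\vdash_{\mathtt{CHC}}s$ means $s$ is derivable from the sequents in $S$ (used as extra axioms). $\Gamma^{\wedge}$ is the left-associated conjunction of $\Gamma$, or $1$ if $\Gamma=\emptyset$; $\Pi^{\vee}$ is $\varphi$ if $\Pi=\{\varphi\}$ and $0$ if $\Pi=\emptyset$. $\tau(\Gamma\blacktriangleright\Pi)$ is the inequation $\Gamma^{\wedge}\le\Pi^{\vee}$ (i.e. the equation $\Gamma^{\wedge}\approx\Gamma^{\wedge}\wedge\Pi^{\vee}$), and $\tau(S)=\{\tau(s):s\in S\}$. A connexive Heyting algebra is an algebra $\langle A,\wedge,\vee,\rightarrow,0,1\rangle$ whose $\{\wedge,\vee,0,1\}$-reduct is a bounded distributive lattice (order $\le$) satisfying, with $\neg x:=x\rightarrow0$: (C1) $(x\rightarrow y)\rightarrow((y\rightarrow z)\rightarrow(x\rightarrow z))=1$; (C2) $(x\rightarrow y)\rightarrow\neg(x\rightarrow\neg y)=1$; (C3) $x\wedge(x\rightarrow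 y)=x\wedge y$; (C4) $x\rightarrow y\le(z\wedge x)\rightarrow(z\wedge y)$; (C5) $x\rightarrow y\le(z\vee x)\rightarrow(z\vee y)$. $\vDash_{\mathcal{CHA}}$ is equational consequence over the class of connexive Heyting algebras. -}

module Defs where

open import Data.Nat using (ℕ)
open import Data.List using (List; []; _∷_; _++_; foldl)
open import Data.List.Membership.Propositional using (_∈_)
open import Data.Maybe using (Maybe; just; nothing)
open import Data.Product using (_×_; _,_; Σ; ∃)
open import Relation.Binary.PropositionalEquality using (_≡_)
open import Algebra.Core using (Op₂)
open import Algebra.Lattice.Structures using (IsDistributiveLattice)

infixr 5 _⇒_
infixr 6 _∨_
infixr 7 _∧_

data Formula : Set where
  var : ℕ → Formula
  _∧_ _∨_ _⇒_ : Formula → Formula → Formula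
  𝟘 𝟙 : Formula

¬_ : Formula → Formula
¬ α = α ⇒ 𝟘

-- Sequents Γ ▶ Π.  Γ is a finite set of formulas, represented by a list
-- taken up to set-equality (same members); Π is empty or a singleton.

Ctx : Set
Ctx = List Formula

_≋_ : Ctx → Ctx → Set
Γ ≋ Δ = (∀ {φ} → φ ∈ Γ → φ ∈ Δ) × (∀ {φ} → φ ∈ Δ → φ ∈ Γ)

infix 4 _▶_
record Sequent : Set where
  constructor _▶_
  field
    ante : Ctx
    succ : Maybe Formula

-- S ⊢ s : s is derivable in CHC from the sequents in S (extra axioms).
-- "α,Γ" is α ∷ Γ, "Γ,Δ" is Γ ++ Δ; the rule `set` expresses that
-- antecedents are sets (lists with the same members denote the same set).
infix 3 _⊢_
data _⊢_ (S : Sequent → Set) : Sequent → Set where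
  ax   : ∀ {s} → S s → S ⊢ s
  set  : ∀ {Γ Γ' Π} → Γ ≋ Γ' → S ⊢ Γ ▶ Π → S ⊢ Γ' ▶ Π
  id   : ∀ {α} → S ⊢ (α ∷ []) ▶ just α
  ax0  : S ⊢ (𝟘 ∷ []) ▶ nothing
  ax1  : S ⊢ [] ▶ just 𝟙
  wl   : ∀ {α Γ Π} → S ⊢ Γ ▶ Π → S ⊢ (α ∷ Γ) ▶ Π
  wr   : ∀ {α Γ} → S ⊢ Γ ▶ nothing → S ⊢ Γ ▶ just α
  cut  : ∀ {α Γ Δ Π} → S ⊢ Γ ▶ just α → S ⊢ (α ∷ Δ) ▶ Π → S ⊢ (Γ ++ Δ) ▶ Π
  ∧l₁  : ∀ {α β Γ Π} → S ⊢ (α ∷ Γ) ▶ Π → S ⊢ ((α ∧ β) ∷ Γ) ▶ Π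
  ∧l₂  : ∀ {α β Γ Π} → S ⊢ (β ∷ Γ) ▶ Π → S ⊢ ((α ∧ β) ∷ Γ) ▶ Π
  ∧r   : ∀ {α β Γ} → S ⊢ Γ ▶ just α → S ⊢ Γ ▶ just β → S ⊢ Γ ▶ just (α ∧ β)
  ∨r₁  : ∀ {α β Γ} → S ⊢ Γ ▶ just α → S ⊢ Γ ▶ just (α ∨ β)
  ∨r₂  : ∀ {α β Γ} → S ⊢ Γ ▶ just β → S ⊢ Γ ▶ just (α ∨ β)
  ∨l   : ∀ {α β Γ Π} → S ⊢ (α ∷ Γ) ▶ Π → S ⊢ (β ∷ Γ) ▶ Π → S ⊢ ((α ∨ β) ∷ Γ) ▶ Π
  ⇒la  : ∀ {α β Γ Δ Π} → S ⊢ Γ ▶ just α → S ⊢ (β ∷ Δ) ▶ Π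
       → S ⊢ ((α ⇒ β) ∷ (Δ ++ Γ)) ▶ Π
  ⇒lb  : ∀ {α β Γ Δ} → S ⊢ ((¬ α) ∷ Γ) ▶ just β → S ⊢ (α ∷ β ∷ Δ) ▶ nothing
       → S ⊢ ((α ⇒ β) ∷ (Γ ++ Δ)) ▶ nothing
  ⇒r   : ∀ {α β Γ Δ} → S ⊢ (α ∷ Γ) ▶ just β → S ⊢ ((¬ α) ∷ β ∷ Δ) ▶ nothing
       → S ⊢ (Γ ++ Δ) ▶ just (α ⇒ β)

-- Translation τ into inequations (equations between formulas/terms)

Equation : Set
Equation = Formula × Formula

conj : Ctx → Formula
conj []       = 𝟙
conj (γ ∷ Γ)  = foldl _∧_ γ Γ

disj : Maybe Formula → Formula
disj (just φ) = φ
disj nothing  = 𝟘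

τ : Sequent → Equation
τ (Γ ▶ Π) = conj Γ , conj Γ ∧ disj Π

τS : (Sequent → Set) → Equation → Set
τS S e = Σ Sequent (λ s → S s × τ s ≡ e)

-- Connexive Heyting algebras (setoid-based: carrier with a congruence ≈)

record CHA : Set₁ where
  infixr 5 _→'_
  infixr 6 _∨'_
  infixr 7 _∧'_
  infix 4 _≈_ _≤_
  field
    Carrier : Set
    _≈_     : Carrier → Carrier → Set
    _∧'_ _∨'_ _→'_ : Op₂ Carrier
    0' 1'   : Carrier
    isDistributiveLattice : IsDistributiveLattice _≈_ _∨'_ _∧'_
    →-cong  : ∀ {x x' y y'} → x ≈ x' → y ≈ y' → (x →' y) ≈ (x' →' y')
    0-bot   : ∀ x → (0' ∨' x) ≈ x
    1-top   : ∀ x → (1' ∧' x) ≈ x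

  _≤_ : Carrier → Carrier → Set
  x ≤ y = x ≈ (x ∧' y)

  ¬' : Carrier → Carrier
  ¬' x = x →' 0'

  field
    C1 : ∀ x y z → ((x →' y) →' ((y →' z) →' (x →' z))) ≈ 1'
    C2 : ∀ x y → ((x →' y) →' ¬' (x →' ¬' y)) ≈ 1'
    C3 : ∀ x y → (x ∧' (x →' y)) ≈ (x ∧' y)
    C4 : ∀ x y z → (x →' y) ≤ ((z ∧' x) →' (z ∧' y))
    C5 : ∀ x y z → (x →' y) ≤ ((z ∨' x) →' (z ∨' y))

⟦_⟧ : Formula → (A : CHA) → (ℕ → CHA.Carrier A) → CHA.Carrier A
⟦ var n ⟧ A v = v n
⟦ α ∧ β ⟧ A v = CHA._∧'_ A (⟦ α ⟧ A v) (⟦ β ⟧ A v)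
⟦ α ∨ β ⟧ A v = CHA._∨'_ A (⟦ α ⟧ A v) (⟦ β ⟧ A v)
⟦ α ⇒ β ⟧ A v = CHA._→'_ A (⟦ α ⟧ A v) (⟦ β ⟧ A v)
⟦ 𝟘 ⟧ A v = CHA.0' A
⟦ 𝟙 ⟧ A v = CHA.1' A

Holds : (A : CHA) → (ℕ → CHA.Carrier A) → Equation → Set
Holds A v (t , u) = CHA._≈_ A (⟦ t ⟧ A v) (⟦ u ⟧ A v)

_⊨CHA_ : (Equation → Set) → Equation → Set₁
E ⊨CHA e = (A : CHA) (v : ℕ → CHA.Carrier A) →
           (∀ e' → E e' → Holds A v e') → Holds A v e

module Submission where

open import Defs
open import Data.Nat using (ℕ; zero; suc)
open import Data.Bool using (Bool; true; false; not; T; _xor_) renaming (_∧_ to _&&_; _∨_ to _||_)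
open import Data.Bool.Properties using (T-∧)
open import Data.Unit using (tt)
open import Data.Fin using (Fin; zero; suc)
open import Data.Vec using (Vec; []; _∷_; lookup)
open import Data.List using (List; []; _∷_; _++_; map; foldl)
open import Data.List.Membership.Propositional using (_∈_)
open import Data.List.Membership.Propositional.Properties using (∈-++⁻)
open import Data.List.Relation.Binary.Subset.Propositional using (_⊆_)
open import Data.List.Relation.Binary.Subset.Propositional.Properties
  using (⊆-refl; ∷⁺ʳ; xs⊆xs++ys; xs⊆ys++xs)
open import Data.List.Relation.Unary.Any using (here; there)
open import Data.Maybe using (just; nothing)
open import Data.Product using (_×_; _,_; proj₁; proj₂)
open import Data.Sum using ([_,_])
open import Function using (_∘_)
open import Function.Bundles using (Equivalence)
open import Relation.Binary.PropositionalEquality using (_≡_; refl; sym; subst; subst₂; cong₂)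
open import Relation.Binary.Structures using (IsEquivalence)
open import Algebra.Lattice.Structures using (IsLattice)

-- Completeness goes through the Lindenbaum–Tarski algebra: formulas up to
-- S-interderivability form a connexive Heyting algebra in which the identity
-- valuation validates τ(S), hence τ(s), and τ(s) read back there is a
-- derivation of s. The delicate part is verifying (C1)–(C5): rule (→-r) has a
-- second premise with empty succedent, and such sequents behave classically
-- (cutting on ¬φ gives a case split on φ), so these premises are discharged
-- by a Kalmár-style truth-table argument.

++-⊆ : ∀ {Γ Δ Θ : Ctx} → Γ ⊆ Θ → Δ ⊆ Θ → Γ ++ Δ ⊆ Θ
++-⊆ {Γ} f g = [ f , g ] ∘ ∈-++⁻ Γ

++-idem : ∀ Γ → (Γ ++ Γ) ≋ Γ
++-idem Γ = ++-⊆ ⊆-refl ⊆-refl , xs⊆xs++ys Γ Γ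

[]-⊆ : ∀ {Γ : Ctx} → [] ⊆ Γ
[]-⊆ ()

infixr 5 _⟶_
infixr 6 _∣_
infixr 7 _&_
data Term (n : ℕ) : Set where
  at : Fin n → Term n
  _&_ _∣_ _⟶_ : Term n → Term n → Term n
  ⊥ᵗ ⊤ᵗ : Term n

⟦_⟧ᵗ : ∀ {n} → Term n → Vec Formula n → Formula
⟦ at i ⟧ᵗ ρ = lookup ρ i
⟦ a & b ⟧ᵗ ρ = ⟦ a ⟧ᵗ ρ ∧ ⟦ b ⟧ᵗ ρ
⟦ a ∣ b ⟧ᵗ ρ = ⟦ a ⟧ᵗ ρ ∨ ⟦ b ⟧ᵗ ρ
⟦ a ⟶ b ⟧ᵗ ρ = ⟦ a ⟧ᵗ ρ ⇒ ⟦ b ⟧ᵗ ρ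
⟦ ⊥ᵗ ⟧ᵗ ρ = 𝟘
⟦ ⊤ᵗ ⟧ᵗ ρ = 𝟙

¬ᵗ : ∀ {n} → Term n → Term n
¬ᵗ t = t ⟶ ⊥ᵗ

_⇔ᵇ_ : Bool → Bool → Bool
x ⇔ᵇ y = not (x xor y)

-- Implication is read as the biconditional: besides modus ponens, CHC refutes
-- α ⇒ β from ¬α and β by the connexive rule (→-l(b)).
evalᵇ : ∀ {n} → Term n → Vec Bool n → Bool
evalᵇ (at i) b = lookup b i
evalᵇ (x & y) b = evalᵇ x b && evalᵇ y b
evalᵇ (x ∣ y) b = evalᵇ x b || evalᵇ y b
evalᵇ (x ⟶ y) b = evalᵇ x b ⇔ᵇ evalᵇ y b
evalᵇ ⊥ᵗ b = false
evalᵇ ⊤ᵗ b = true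

allValuations : ∀ n → (Vec Bool n → Bool) → Bool
allValuations zero f = f []
allValuations (suc n) f = allValuations n (f ∘ (true ∷_)) && allValuations n (f ∘ (false ∷_))

allValuations-sound : ∀ n f → T (allValuations n f) → ∀ b → T (f b)
allValuations-sound zero f p [] = p
allValuations-sound (suc n) f p (true ∷ b) =
  allValuations-sound n _ (proj₁ (Equivalence.to T-∧ p)) b
allValuations-sound (suc n) f p (false ∷ b) =
  allValuations-sound n _ (proj₂ (Equivalence.to T-∧ p)) b

falsifiedBy : ∀ {n} → Vec Bool n → List (Term n) → Bool
falsifiedBy b [] = false
falsifiedBy b (t ∷ ts) = not (evalᵇ t b) || falsifiedBy b ts

literal : Bool → Formula → Formula
literal true φ = φ
literal false φ = ¬ φ

extendBy : ∀ {n} → Vec Formula n → Vec Bool n → Ctx → Ctx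
extendBy [] [] Γ = Γ
extendBy (φ ∷ ρ) (c ∷ b) Γ = extendBy ρ b (literal c φ ∷ Γ)

⊆-extendBy : ∀ {n} (ρ : Vec Formula n) b Γ → Γ ⊆ extendBy ρ b Γ
⊆-extendBy [] [] Γ m = m
⊆-extendBy (φ ∷ ρ) (c ∷ b) Γ m = ⊆-extendBy ρ b _ (there m)

literal∈extendBy : ∀ {n} (ρ : Vec Formula n) b Γ i →
                   literal (lookup b i) (lookup ρ i) ∈ extendBy ρ b Γ
literal∈extendBy (φ ∷ ρ) (c ∷ b) Γ zero = ⊆-extendBy ρ b _ (here refl)
literal∈extendBy (φ ∷ ρ) (c ∷ b) Γ (suc i) = literal∈extendBy ρ b _ i

module Derivations (S : Sequent → Set) where

  infix 3 _⊢ᶠ_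
  _⊢ᶠ_ : Ctx → Formula → Set
  Γ ⊢ᶠ φ = S ⊢ Γ ▶ just φ

  Refutable : Ctx → Set
  Refutable Γ = S ⊢ Γ ▶ nothing

  weaken-++ : ∀ {Γ Π} Δ → S ⊢ Γ ▶ Π → S ⊢ (Δ ++ Γ) ▶ Π
  weaken-++ [] p = p
  weaken-++ (x ∷ Δ) p = wl (weaken-++ Δ p)

  weaken : ∀ {Γ Δ Π} → Γ ⊆ Δ → S ⊢ Γ ▶ Π → S ⊢ Δ ▶ Π
  weaken {Γ} {Δ} Γ⊆Δ p = set (++-⊆ ⊆-refl Γ⊆Δ , xs⊆xs++ys Δ Γ) (weaken-++ Δ p)

  assumption : ∀ {Γ φ} → φ ∈ Γ → Γ ⊢ᶠ φ
  assumption m = weaken (λ { (here refl) → m }) id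

  #0 : ∀ {a Γ} → a ∷ Γ ⊢ᶠ a
  #0 = assumption (here refl)

  #1 : ∀ {a b Γ} → a ∷ b ∷ Γ ⊢ᶠ b
  #1 = assumption (there (here refl))

  #2 : ∀ {a b c Γ} → a ∷ b ∷ c ∷ Γ ⊢ᶠ c
  #2 = assumption (there (there (here refl)))

  have : ∀ {Γ α Π} → Γ ⊢ᶠ α → S ⊢ (α ∷ Γ) ▶ Π → S ⊢ Γ ▶ Π
  have {Γ} p q = set (++-idem Γ) (cut p q)

  via : ∀ {Γ α Π} → Γ ⊢ᶠ α → S ⊢ (α ∷ []) ▶ Π → S ⊢ Γ ▶ Π
  via p q = have p (weaken (∷⁺ʳ _ []-⊆) q)

  ⇒-elim : ∀ {Γ α β} → Γ ⊢ᶠ α ⇒ β → Γ ⊢ᶠ α → Γ ⊢ᶠ β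
  ⇒-elim f a = have f (⇒la {Δ = []} a id)

  ¬-elim : ∀ {Γ α} → Γ ⊢ᶠ α → Γ ⊢ᶠ ¬ α → Refutable Γ
  ¬-elim a n = have n (⇒la {Δ = []} a ax0)

  ⇒-connexive : ∀ {Γ α β} → Γ ⊢ᶠ α ⇒ β → Γ ⊢ᶠ β → Γ ⊢ᶠ ¬ α → Refutable Γ
  ⇒-connexive f b n =
    have n (have (wl b) (have (wl (wl f))
      (weaken (∷⁺ʳ _ (∷⁺ʳ _ (∷⁺ʳ _ []-⊆)))
        (⇒lb {Γ = _ ∷ []} {Δ = _ ∷ []} #1 (¬-elim #0 #2)))))

  ⇒-intro : ∀ {Γ α β} → α ∷ Γ ⊢ᶠ β → Refutable (¬ α ∷ β ∷ Γ) → Γ ⊢ᶠ α ⇒ β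
  ⇒-intro {Γ} p q = set (++-idem Γ) (⇒r p q)

  𝟘-elim : ∀ {Γ} → Refutable (𝟘 ∷ Γ)
  𝟘-elim = weaken (∷⁺ʳ _ []-⊆) ax0

  𝟙-intro : ∀ {Γ} → Γ ⊢ᶠ 𝟙
  𝟙-intro = weaken []-⊆ ax1

  ¬-intro : ∀ {Γ α} → Refutable (α ∷ Γ) → Γ ⊢ᶠ ¬ α
  ¬-intro p = ⇒-intro (wr p) (wl 𝟘-elim)

  ∧-elimˡ : ∀ {Γ α β} → Γ ⊢ᶠ α ∧ β → Γ ⊢ᶠ α
  ∧-elimˡ p = have p (∧l₁ #0)

  ∧-elimʳ : ∀ {Γ α β} → Γ ⊢ᶠ α ∧ β → Γ ⊢ᶠ β
  ∧-elimʳ p = have p (∧l₂ #0)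

  ∨-elim : ∀ {Γ α β Π} → Γ ⊢ᶠ α ∨ β → S ⊢ (α ∷ Γ) ▶ Π → S ⊢ (β ∷ Γ) ▶ Π → S ⊢ Γ ▶ Π
  ∨-elim p a b = have p (∨l a b)

  refute-by-cases : ∀ {Γ φ} → Refutable (φ ∷ Γ) → Refutable (¬ φ ∷ Γ) → Refutable Γ
  refute-by-cases p q = have (¬-intro p) q

  Decides : Ctx → Bool → Formula → Set
  Decides Γ c φ = Γ ⊢ᶠ literal c φ

  ⇒-decides : ∀ {Γ} c d {α β} → Decides Γ c α → Decides Γ d β → Decides Γ (c ⇔ᵇ d) (α ⇒ β)
  ⇒-decides true  true  a b = ⇒-intro (wl b) (¬-elim (wl (wl a)) #0)
  ⇒-decides true  false a b = ¬-intro (¬-elim (⇒-elim #0 (wl a)) (wl b))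
  ⇒-decides false true  a b = ¬-intro (⇒-connexive #0 (wl b) (wl a))
  ⇒-decides false false a b = ⇒-intro (wr (¬-elim #0 (wl a))) (¬-elim #1 (wl (wl b)))

  ∧-decides : ∀ {Γ} c d {α β} → Decides Γ c α → Decides Γ d β → Decides Γ (c && d) (α ∧ β)
  ∧-decides true  true  a b = ∧r a b
  ∧-decides true  false a b = ¬-intro (¬-elim (∧-elimʳ #0) (wl b))
  ∧-decides false d     a b = ¬-intro (¬-elim (∧-elimˡ #0) (wl a))

  ∨-decides : ∀ {Γ} c d {α β} → Decides Γ c α → Decides Γ d β → Decides Γ (c || d) (α ∨ β)
  ∨-decides true  d     a b = ∨r₁ a
  ∨-decides false true  a b = ∨r₂ b
  ∨-decides false false a b = ¬-intro (∨-elim #0 (¬-elim #0 (wl (wl a))) (¬-elim #0 (wl (wl b))))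

  kalmar : ∀ {n Γ} (ρ : Vec Formula n) (b : Vec Bool n) →
           (∀ i → Decides Γ (lookup b i) (lookup ρ i)) →
           ∀ t → Decides Γ (evalᵇ t b) (⟦ t ⟧ᵗ ρ)
  kalmar ρ b atoms (at i)  = atoms i
  kalmar ρ b atoms (x & y) = ∧-decides (evalᵇ x b) (evalᵇ y b) (kalmar ρ b atoms x) (kalmar ρ b atoms y)
  kalmar ρ b atoms (x ∣ y) = ∨-decides (evalᵇ x b) (evalᵇ y b) (kalmar ρ b atoms x) (kalmar ρ b atoms y)
  kalmar ρ b atoms (x ⟶ y) = ⇒-decides (evalᵇ x b) (evalᵇ y b) (kalmar ρ b atoms x) (kalmar ρ b atoms y)
  kalmar ρ b atoms ⊥ᵗ      = ¬-intro 𝟘-elim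
  kalmar ρ b atoms ⊤ᵗ      = 𝟙-intro

  refute-by-valuations : ∀ {n} (ρ : Vec Formula n) Γ →
                         (∀ b → Refutable (extendBy ρ b Γ)) → Refutable Γ
  refute-by-valuations []      Γ h = h []
  refute-by-valuations (φ ∷ ρ) Γ h =
    refute-by-cases (refute-by-valuations ρ (φ ∷ Γ) (h ∘ (true ∷_)))
                    (refute-by-valuations ρ (¬ φ ∷ Γ) (h ∘ (false ∷_)))

  refute-falsified : ∀ {n Γ} (ρ : Vec Formula n) b ts →
                     (∀ i → Decides Γ (lookup b i) (lookup ρ i)) →
                     map (λ t → ⟦ t ⟧ᵗ ρ) ts ⊆ Γ → T (falsifiedBy b ts) → Refutable Γ
  refute-falsified ρ b (t ∷ ts) atoms ts⊆Γ falsified with evalᵇ t b in eq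
  ... | false = ¬-elim (assumption (ts⊆Γ (here refl)))
                       (subst (λ c → Decides _ c (⟦ t ⟧ᵗ ρ)) eq (kalmar ρ b atoms t))
  ... | true  = refute-falsified ρ b ts atoms (ts⊆Γ ∘ there) falsified

  truth-table : ∀ {n} (ρ : Vec Formula n) ts →
                T (allValuations n (λ b → falsifiedBy b ts)) →
                Refutable (map (λ t → ⟦ t ⟧ᵗ ρ) ts)
  truth-table {n} ρ ts unsat = refute-by-valuations ρ _ λ b →
    refute-falsified ρ b ts (assumption ∘ literal∈extendBy ρ b _) (⊆-extendBy ρ b _)
                     (allValuations-sound n _ unsat b)

  module _ (x y z : Formula) where
    private
      ρ : Vec Formula 3
      ρ = x ∷ y ∷ z ∷ []

      X Y Z : Term 3
      X = at zero
      Y = at (suc zero)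
      Z = at (suc (suc zero))

    ⇒-trans : (y ⇒ z) ∷ (x ⇒ y) ∷ [] ⊢ᶠ x ⇒ z
    ⇒-trans = ⇒-intro (⇒-elim #1 (⇒-elim #2 #0))
                      (truth-table ρ (¬ᵗ X ∷ Z ∷ (Y ⟶ Z) ∷ (X ⟶ Y) ∷ []) tt)

    C1-derivable : [] ⊢ᶠ (x ⇒ y) ⇒ ((y ⇒ z) ⇒ (x ⇒ z))
    C1-derivable =
      ⇒-intro (⇒-intro ⇒-trans (truth-table ρ (¬ᵗ (Y ⟶ Z) ∷ (X ⟶ Z) ∷ (X ⟶ Y) ∷ []) tt))
              (truth-table ρ (¬ᵗ (X ⟶ Y) ∷ ((Y ⟶ Z) ⟶ (X ⟶ Z)) ∷ []) tt)

    C2-derivable : [] ⊢ᶠ (x ⇒ y) ⇒ ¬ (x ⇒ ¬ y)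
    C2-derivable = ⇒-intro (¬-intro (truth-table ρ ((X ⟶ ¬ᵗ Y) ∷ (X ⟶ Y) ∷ []) tt))
                           (truth-table ρ (¬ᵗ (X ⟶ Y) ∷ ¬ᵗ (X ⟶ ¬ᵗ Y) ∷ []) tt)

    C4-derivable : (x ⇒ y) ∷ [] ⊢ᶠ (z ∧ x) ⇒ (z ∧ y)
    C4-derivable = ⇒-intro (∧r (∧-elimˡ #0) (⇒-elim #1 (∧-elimʳ #0)))
                           (truth-table ρ (¬ᵗ (Z & X) ∷ (Z & Y) ∷ (X ⟶ Y) ∷ []) tt)

    C5-derivable : (x ⇒ y) ∷ [] ⊢ᶠ (z ∨ x) ⇒ (z ∨ y)
    C5-derivable = ⇒-intro (∨-elim #0 (∨r₁ #0) (∨r₂ (⇒-elim #2 #0)))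
                           (truth-table ρ (¬ᵗ (Z ∣ X) ∷ (Z ∣ Y) ∷ (X ⟶ Y) ∷ []) tt)

  C3-derivable : ∀ x y → x ∧ (x ⇒ y) ∷ [] ⊢ᶠ x ∧ y
  C3-derivable x y = ∧r (∧-elimˡ #0) (⇒-elim (∧-elimʳ #0) (∧-elimˡ #0))

  C3-converse : ∀ x y → x ∧ y ∷ [] ⊢ᶠ x ∧ (x ⇒ y)
  C3-converse x y = ∧r (∧-elimˡ #0) (⇒-intro (∧-elimʳ #1) (¬-elim (∧-elimˡ #2) #0))

  infix 4 _⊣⊢_
  _⊣⊢_ : Formula → Formula → Set
  a ⊣⊢ b = (a ∷ [] ⊢ᶠ b) × (b ∷ [] ⊢ᶠ a)

  ⊣⊢-isEquivalence : IsEquivalence _⊣⊢_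
  ⊣⊢-isEquivalence = record
    { refl  = id , id
    ; sym   = λ (p , q) → q , p
    ; trans = λ (p , q) (r , s) → cut p r , cut s q
    }

  ⇒-mono : ∀ {a a' b b'} → a ⊣⊢ a' → b ⊣⊢ b' → (a ⇒ b) ∷ [] ⊢ᶠ a' ⇒ b'
  ⇒-mono (a⊢a' , a'⊢a) (b⊢b' , b'⊢b) =
    ⇒-intro (via (⇒-elim #1 (via #0 a'⊢a)) b⊢b')
            (⇒-connexive #2 (via #1 b'⊢b) (¬-intro (¬-elim (via #0 a⊢a') #1)))

  ⇒-cong : ∀ {a a' b b'} → a ⊣⊢ a' → b ⊣⊢ b' → a ⇒ b ⊣⊢ a' ⇒ b'
  ⇒-cong (p , p') (q , q') = ⇒-mono (p , p') (q , q') , ⇒-mono (p' , p) (q' , q)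

  ⊣⊢-isLattice : IsLattice _⊣⊢_ _∨_ _∧_
  ⊣⊢-isLattice = record
    { isEquivalence = ⊣⊢-isEquivalence
    ; ∨-comm  = λ _ _ → ∨-swap , ∨-swap
    ; ∨-assoc = λ _ _ _ →
        ∨-elim #0 (∨-elim #0 (∨r₁ #0) (∨r₂ (∨r₁ #0))) (∨r₂ (∨r₂ #0)) ,
        ∨-elim #0 (∨r₁ (∨r₁ #0)) (∨-elim #0 (∨r₁ (∨r₂ #0)) (∨r₂ #0))
    ; ∨-cong  = λ (p , p') (q , q') →
        ∨-elim #0 (∨r₁ (via #0 p)) (∨r₂ (via #0 q)) ,
        ∨-elim #0 (∨r₁ (via #0 p')) (∨r₂ (via #0 q'))
    ; ∧-comm  = λ _ _ → ∧-swap , ∧-swap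
    ; ∧-assoc = λ _ _ _ →
        ∧r (∧-elimˡ (∧-elimˡ #0)) (∧r (∧-elimʳ (∧-elimˡ #0)) (∧-elimʳ #0)) ,
        ∧r (∧r (∧-elimˡ #0) (∧-elimˡ (∧-elimʳ #0))) (∧-elimʳ (∧-elimʳ #0))
    ; ∧-cong  = λ (p , p') (q , q') →
        ∧r (via (∧-elimˡ #0) p) (via (∧-elimʳ #0) q) ,
        ∧r (via (∧-elimˡ #0) p') (via (∧-elimʳ #0) q')
    ; absorptive =
        (λ _ _ → ∨-elim #0 #0 (∧-elimˡ #0) , ∨r₁ #0) ,
        (λ _ _ → ∧-elimˡ #0 , ∧r #0 (∨r₁ #0))
    }
    where
      ∨-swap : ∀ {a b} → a ∨ b ∷ [] ⊢ᶠ b ∨ a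
      ∨-swap = ∨-elim #0 (∨r₂ #0) (∨r₁ #0)

      ∧-swap : ∀ {a b} → a ∧ b ∷ [] ⊢ᶠ b ∧ a
      ∧-swap = ∧r (∧-elimʳ #0) (∧-elimˡ #0)

  ∨-distribˡ-∧ : ∀ x y z → x ∨ (y ∧ z) ⊣⊢ (x ∨ y) ∧ (x ∨ z)
  ∨-distribˡ-∧ _ _ _ =
    ∨-elim #0 (∧r (∨r₁ #0) (∨r₁ #0)) (∧r (∨r₂ (∧-elimˡ #0)) (∨r₂ (∧-elimʳ #0))) ,
    ∨-elim (∧-elimˡ #0) (∨r₁ #0) (∨-elim (∧-elimʳ #1) (∨r₁ #0) (∨r₂ (∧r #1 #0)))

  ∨-distribʳ-∧ : ∀ x y z → (y ∧ z) ∨ x ⊣⊢ (y ∨ x) ∧ (z ∨ x)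
  ∨-distribʳ-∧ _ _ _ =
    ∨-elim #0 (∧r (∨r₁ (∧-elimˡ #0)) (∨r₁ (∧-elimʳ #0))) (∧r (∨r₂ #0) (∨r₂ #0)) ,
    ∨-elim (∧-elimˡ #0) (∨-elim (∧-elimʳ #1) (∨r₁ (∧r #1 #0)) (∨r₂ #0)) (∨r₂ #0)

  ∧-distribˡ-∨ : ∀ x y z → x ∧ (y ∨ z) ⊣⊢ (x ∧ y) ∨ (x ∧ z)
  ∧-distribˡ-∨ _ _ _ =
    ∨-elim (∧-elimʳ #0) (∨r₁ (∧r (∧-elimˡ #1) #0)) (∨r₂ (∧r (∧-elimˡ #1) #0)) ,
    ∨-elim #0 (∧r (∧-elimˡ #0) (∨r₁ (∧-elimʳ #0))) (∧r (∧-elimˡ #0) (∨r₂ (∧-elimʳ #0)))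

  ∧-distribʳ-∨ : ∀ x y z → (y ∨ z) ∧ x ⊣⊢ (y ∧ x) ∨ (z ∧ x)
  ∧-distribʳ-∨ _ _ _ =
    ∨-elim (∧-elimˡ #0) (∨r₁ (∧r #0 (∧-elimʳ #1))) (∨r₂ (∧r #0 (∧-elimʳ #1))) ,
    ∨-elim #0 (∧r (∨r₁ (∧-elimˡ #0)) (∧-elimʳ #0)) (∧r (∨r₂ (∧-elimˡ #0)) (∧-elimʳ #0))

  Lindenbaum : CHA
  Lindenbaum = record
    { Carrier = Formula
    ; _≈_ = _⊣⊢_
    ; _∧'_ = _∧_ ; _∨'_ = _∨_ ; _→'_ = _⇒_ ; 0' = 𝟘 ; 1' = 𝟙
    ; isDistributiveLattice = record
        { isLattice = ⊣⊢-isLattice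
        ; ∨-distrib-∧ = ∨-distribˡ-∧ , ∨-distribʳ-∧
        ; ∧-distrib-∨ = ∧-distribˡ-∨ , ∧-distribʳ-∨
        }
    ; →-cong = ⇒-cong
    ; 0-bot  = λ _ → ∨-elim #0 (wr 𝟘-elim) #0 , ∨r₂ #0
    ; 1-top  = λ _ → ∧-elimʳ #0 , ∧r 𝟙-intro #0
    ; C1 = λ x y z → 𝟙-intro , weaken []-⊆ (C1-derivable x y z)
    ; C2 = λ x y → 𝟙-intro , weaken []-⊆ (C2-derivable x y x)
    ; C3 = λ x y → C3-derivable x y , C3-converse x y
    ; C4 = λ x y z → ∧r #0 (C4-derivable x y z) , ∧-elimˡ #0
    ; C5 = λ x y z → ∧r #0 (C5-derivable x y z) , ∧-elimˡ #0
    }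

  ⟦⟧-var : ∀ φ → ⟦ φ ⟧ Lindenbaum var ≡ φ
  ⟦⟧-var (var n) = refl
  ⟦⟧-var (a ∧ b) = cong₂ _∧_ (⟦⟧-var a) (⟦⟧-var b)
  ⟦⟧-var (a ∨ b) = cong₂ _∨_ (⟦⟧-var a) (⟦⟧-var b)
  ⟦⟧-var (a ⇒ b) = cong₂ _⇒_ (⟦⟧-var a) (⟦⟧-var b)
  ⟦⟧-var 𝟘 = refl
  ⟦⟧-var 𝟙 = refl

  holds-var⁺ : ∀ {t u} → t ⊣⊢ u → Holds Lindenbaum var (t , u)
  holds-var⁺ {t} {u} = subst₂ _⊣⊢_ (sym (⟦⟧-var t)) (sym (⟦⟧-var u))

  holds-var⁻ : ∀ {t u} → Holds Lindenbaum var (t , u) → t ⊣⊢ u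
  holds-var⁻ {t} {u} = subst₂ _⊣⊢_ (⟦⟧-var t) (⟦⟧-var u)

  foldl-∧-elim : ∀ {Δ} acc Γ → Δ ⊢ᶠ foldl _∧_ acc Γ → (Δ ⊢ᶠ acc) × (∀ {φ} → φ ∈ Γ → Δ ⊢ᶠ φ)
  foldl-∧-elim acc []      p = p , λ ()
  foldl-∧-elim acc (x ∷ Γ) p with foldl-∧-elim (acc ∧ x) Γ p
  ... | q , rest = ∧-elimˡ q , λ { (here refl) → ∧-elimʳ q ; (there m) → rest m }

  foldl-∧-intro : ∀ {Δ} acc Γ → Δ ⊢ᶠ acc → (∀ {φ} → φ ∈ Γ → Δ ⊢ᶠ φ) → Δ ⊢ᶠ foldl _∧_ acc Γ
  foldl-∧-intro acc []      a f = a
  foldl-∧-intro acc (x ∷ Γ) a f = foldl-∧-intro (acc ∧ x) Γ (∧r a (f (here refl))) (f ∘ there)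

  conj-elim : ∀ Γ {φ} → φ ∈ Γ → conj Γ ∷ [] ⊢ᶠ φ
  conj-elim (γ ∷ Γ) (here refl) = proj₁ (foldl-∧-elim γ Γ #0)
  conj-elim (γ ∷ Γ) (there m)   = proj₂ (foldl-∧-elim γ Γ #0) m

  conj-intro : ∀ Γ → Γ ⊢ᶠ conj Γ
  conj-intro []      = ax1
  conj-intro (γ ∷ Γ) = foldl-∧-intro γ Γ #0 (assumption ∘ there)

  cut-all : ∀ {Δ Π} Γ → (∀ {γ} → γ ∈ Γ → Δ ⊢ᶠ γ) → S ⊢ (Γ ++ Δ) ▶ Π → S ⊢ Δ ▶ Π
  cut-all []      f p = p
  cut-all (γ ∷ Γ) f p = cut-all Γ (f ∘ there) (have (weaken (xs⊆ys++xs _ Γ) (f (here refl))) p)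

  ▶⇒disj : ∀ {Γ} Π → S ⊢ Γ ▶ Π → Γ ⊢ᶠ disj Π
  ▶⇒disj (just φ) p = p
  ▶⇒disj nothing  p = wr p

  disj⇒▶ : ∀ {Γ} Π → Γ ⊢ᶠ disj Π → S ⊢ Γ ▶ Π
  disj⇒▶ (just φ) p = p
  disj⇒▶ nothing  p = have p 𝟘-elim

  τ-holds-in-Lindenbaum : ∀ s → S s → Holds Lindenbaum var (τ s)
  τ-holds-in-Lindenbaum (Γ ▶ Π) s∈S = holds-var⁺
    (∧r #0 (▶⇒disj Π (cut-all Γ (conj-elim Γ) (weaken (xs⊆xs++ys Γ _) (ax s∈S)))) , ∧-elimˡ #0)

  derivable-if-τ-holds : ∀ s → Holds Lindenbaum var (τ s) → S ⊢ s
  derivable-if-τ-holds (Γ ▶ Π) τs = disj⇒▶ Π (via (conj-intro Γ) (∧-elimʳ (proj₁ (holds-var⁻ {conj Γ} {conj Γ ∧ disj Π} τs))))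

lemma4p10 : (S : Sequent → Set) (s : Sequent) → τS S ⊨CHA τ s → S ⊢ s
lemma4p10 S s τS⊨τs = derivable-if-τ-holds s
  (τS⊨τs Lindenbaum var λ { _ (s′ , s′∈S , refl) → τ-holds-in-Lindenbaum s′ s′∈S })
  where open Derivations S
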